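{- Let $(a_i)_{i\ge0}$, $(\beta_i)_{i\ge0}$ be integer sequences, $C_i=\begin{pmatrix}a_i&\beta_i\\1&0\end{pmatrix}$, and let $d,k\in\mathbb{N}$ and $k_0\ge0$ be integers. Suppose the continued fraction is eventually $d$-nice at index $k$ from position $k_0$. Then for all integers $0\le r\le k-k_0$, $$C_{k+r}C_{k+r-1}\cdots C_{k-r}\equiv\begin{pmatrix}0&\gamma_{k,r}\\\gamma_{k,r-1}&0\end{pmatrix}\pmod d.$$ Moreover, if the continued fraction is $(d,r)$-perfect at index $k$, then $C_{k+r+1}C_{k+r}\cdots C_{k-r}\equiv\mathbf{0}\pmod d$.
   Context: For integers $k\ge0$ and $0\le r\le k$ put $\gamma_{k,r}=\beta_{k-r}\beta_{k-r+2}\beta_{k-r+4}\cdots\beta_{k+r}$ (product of $\beta_i$ over $k-r\le i\le k+r$ with $i-k+r$ even), and $\gamma_{k,-1}=1$. The continued fraction (given by the sequences $(a_i),(\beta_i)$) is called eventually $d$-nice at index $k$ from position $k_0$ if $d\mid a_k$ and for all integers $1\le r\le k-k_0$ one has $a_{k-r}\beta_{k+r}\gamma_{k,r-2}\equiv -a_{k+r}\gamma_{k,r-1}\pmod d$. It is called $d$-nice at index $k$ if this holds with $k_0=0$ (i.e. for all $1\le r\le k$). For $0\le r\le k$ it is called $(d,r)$-perfect at index $k$ if it is $d$-nice at index $k$ and $\beta_{k-r}\equiv\beta_{k+r+1}\equiv0\pmod d$. Congruences of matrices are entrywise. -}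

module Defs where

open import Data.Nat using (ℕ; zero; suc; _∸_; _≤_)
import Data.Nat as N
open import Data.Integer using (ℤ; +_; _+_; _*_; -_; _-_)
open import Data.Integer.Divisibility using (_∣_)
open import Data.Product using (_×_)

_≡_[mod_] : ℤ → ℤ → ℕ → Set
x ≡ y [mod d ] = (+ d) ∣ (x - y)

record Mat2 : Set where
  constructor mat
  field
    e11 e12 e21 e22 : ℤ
open Mat2 public

_⊗_ : Mat2 → Mat2 → Mat2
mat a b c d ⊗ mat e f g h = mat (a * e + b * g) (a * f + b * h) (c * e + d * g) (c * f + d * h)

_≡M_[mod_] : Mat2 → Mat2 → ℕ → Set
A ≡M B [mod d ] =
  (e11 A ≡ e11 B [mod d ]) × (e12 A ≡ e12 B [mod d ]) ×
  (e21 A ≡ e21 B [mod d ]) × (e22 A ≡ e22 B [mod d ])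

zeroM : Mat2
zeroM = mat (+ 0) (+ 0) (+ 0) (+ 0)

Cmat : (ℕ → ℤ) → (ℕ → ℤ) → ℕ → Mat2
Cmat a β i = mat (a i) (β i) (+ 1) (+ 0)

-- prodC a β lo n = C_{lo+n} C_{lo+n-1} ⋯ C_{lo}
prodC : (ℕ → ℤ) → (ℕ → ℤ) → ℕ → ℕ → Mat2
prodC a β lo zero = Cmat a β lo
prodC a β lo (suc n) = Cmat a β (lo N.+ suc n) ⊗ prodC a β lo n

stepProd : (ℕ → ℤ) → ℕ → ℕ → ℤ
stepProd β base zero = + 1
stepProd β base (suc n) = β base * stepProd β (base N.+ 2) n

-- γ_{k,r} = β_{k-r} β_{k-r+2} ⋯ β_{k+r}   (intended for 0 ≤ r ≤ k)
γ : (ℕ → ℤ) → ℕ → ℕ → ℤ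
γ β k r = stepProd β (k ∸ r) (suc r)

-- γ' β k r = γ_{k,r-1}, with γ_{k,-1} = 1
γ' : (ℕ → ℤ) → ℕ → ℕ → ℤ
γ' β k zero = + 1
γ' β k (suc r) = γ β k r

-- Eventually d-nice at index k from position k0:
-- d ∣ a_k and for all 1 ≤ r ≤ k - k0 (here r = suc s, s + 1 + k0 ≤ k):
--   a_{k-r} β_{k+r} γ_{k,r-2} ≡ - a_{k+r} γ_{k,r-1} (mod d)
EventuallyNice : (ℕ → ℤ) → (ℕ → ℤ) → ℕ → ℕ → ℕ → Set
EventuallyNice a β d k k0 =
  ((+ d) ∣ a k) ×
  (∀ s → suc s N.+ k0 ≤ k →
     (a (k ∸ suc s) * β (k N.+ suc s) * γ' β k s) ≡ (- (a (k N.+ suc s) * γ β k s)) [mod d ])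

Nice : (ℕ → ℤ) → (ℕ → ℤ) → ℕ → ℕ → Set
Nice a β d k = EventuallyNice a β d k 0

Perfect : (ℕ → ℤ) → (ℕ → ℤ) → ℕ → ℕ → ℕ → Set
Perfect a β d r k =
  Nice a β d k × ((+ d) ∣ β (k ∸ r)) × ((+ d) ∣ β (k N.+ r N.+ 1))

{-# OPTIONS --safe #-}
module Submission where

-- Conjugating the antidiagonal matrix [[0, γ_{k,r}], [γ_{k,r-1}, 0]] by the outer factors,
--   C_{k+r+1} X C_{k-r-1} = [[a_{k+r+1} γ_{k,r} + a_{k-r-1} β_{k+r+1} γ_{k,r-1}, γ_{k,r+1}], [γ_{k,r}, 0]],
-- and niceness is exactly the vanishing of the top-left entry mod d; so the centred
-- products stay antidiagonal, by induction on r. In the perfect case one further factor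
-- gives C_{k+r+1} X = [[β_{k+r+1} γ_{k,r-1}, a_{k+r+1} γ_{k,r}], [0, γ_{k,r}]], which vanishes
-- mod d since d divides β_{k+r+1} and the first factor β_{k-r} of γ_{k,r}.

open import Defs
open import Data.Nat using (ℕ; _+_; _*_; _∸_; _≤_)
open import Data.Integer using (ℤ)
open import Data.Product using (_×_)

open import Data.Nat using (suc)
import Data.Nat.Properties as ℕ
import Data.Nat.Tactic.RingSolver as ℕ-Solver
open import Data.Integer using (+_; -_; _-_) renaming (_+_ to infixl 6 _+ᶻ_; _*_ to infixl 7 _*ᶻ_)
import Data.Integer.Properties as ℤ
open import Data.Integer.Tactic.RingSolver using (solve-∀)
open import Data.Integer.Divisibility using (_∣_)
import Data.Integer.Divisibility.Signed as Signed
open Signed using (∣ᵤ⇒∣; ∣⇒∣ᵤ; ∣-refl; ∣n⇒∣m*n; ∣m⇒∣m*n; ∣m∣n⇒∣m+n; ∣m⇒∣-m)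
open import Data.Product using (_,_)
open import Relation.Binary.Bundles using (Setoid)
open import Relation.Binary.PropositionalEquality
  using (_≡_; refl; sym; trans; cong; cong₂; subst; module ≡-Reasoning)
import Relation.Binary.Reasoning.Setoid as SetoidReasoning

-- Record wrappers of _≡_[mod_] and _≡M_[mod_]: unlike the underlying divisibility
-- statements about ∣ x - y ∣, they let Agda infer the compared values from a proof.
infix 4 _≋_[mod_]
record _≋_[mod_] (x y : ℤ) (d : ℕ) : Set where
  constructor wrap
  field unwrap : x ≡ y [mod d ]
open _≋_[mod_]

infix 4 _≋M_[mod_]
record _≋M_[mod_] (A B : Mat2) (d : ℕ) : Set where
  constructor mat≋
  field
    ≋₁₁ : e11 A ≋ e11 B [mod d ]
    ≋₁₂ : e12 A ≋ e12 B [mod d ]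
    ≋₂₁ : e21 A ≋ e21 B [mod d ]
    ≋₂₂ : e22 A ≋ e22 B [mod d ]

module _ {d : ℕ} where

  private
    from-∣ : ∀ {x y} z → z ≡ x - y → (+ d) Signed.∣ z → x ≋ y [mod d ]
    from-∣ z eq p = wrap (∣⇒∣ᵤ (subst ((+ d) Signed.∣_) eq p))

    to-∣ : ∀ {x y} → x ≋ y [mod d ] → (+ d) Signed.∣ (x - y)
    to-∣ {x} {y} p = ∣ᵤ⇒∣ {i = x - y} (unwrap p)

  ≋-reflexive : ∀ {x y} → x ≡ y → x ≋ y [mod d ]
  ≋-reflexive {x} refl = from-∣ (+ 0) (sym (ℤ.+-inverseʳ x)) (∣n⇒∣m*n (+ 0) ∣-refl)

  ≋-refl : ∀ {x} → x ≋ x [mod d ]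
  ≋-refl = ≋-reflexive refl

  ≋-sym : ∀ {x y} → x ≋ y [mod d ] → y ≋ x [mod d ]
  ≋-sym {x} {y} p = from-∣ _ (eq x y) (∣m⇒∣-m (to-∣ p))
    where eq : ∀ x y → - (x - y) ≡ y - x
          eq = solve-∀

  ≋-trans : ∀ {x y z} → x ≋ y [mod d ] → y ≋ z [mod d ] → x ≋ z [mod d ]
  ≋-trans {x} {y} {z} p q = from-∣ _ (eq x y z) (∣m∣n⇒∣m+n (to-∣ p) (to-∣ q))
    where eq : ∀ x y z → (x - y) +ᶻ (y - z) ≡ x - z
          eq = solve-∀

  +-cong-mod : ∀ {x y u v} → x ≋ y [mod d ] → u ≋ v [mod d ] → x +ᶻ u ≋ y +ᶻ v [mod d ]
  +-cong-mod {x} {y} {u} {v} p q = from-∣ _ (eq x y u v) (∣m∣n⇒∣m+n (to-∣ p) (to-∣ q))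
    where eq : ∀ x y u v → (x - y) +ᶻ (u - v) ≡ (x +ᶻ u) - (y +ᶻ v)
          eq = solve-∀

  *-cong-mod : ∀ {x y u v} → x ≋ y [mod d ] → u ≋ v [mod d ] → x *ᶻ u ≋ y *ᶻ v [mod d ]
  *-cong-mod {x} {y} {u} {v} p q =
    from-∣ _ (eq x y u v) (∣m∣n⇒∣m+n (∣m⇒∣m*n u (to-∣ p)) (∣n⇒∣m*n y (to-∣ q)))
    where eq : ∀ x y u v → (x - y) *ᶻ u +ᶻ y *ᶻ (u - v) ≡ x *ᶻ u - y *ᶻ v
          eq = solve-∀

  ∣⇒≋0 : ∀ x → (+ d) ∣ x → x ≋ + 0 [mod d ]
  ∣⇒≋0 x p = from-∣ x (sym (ℤ.+-identityʳ x)) (∣ᵤ⇒∣ p)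

  ≋-neg⇒+≋0 : ∀ {x y} → y ≋ - x [mod d ] → x +ᶻ y ≋ + 0 [mod d ]
  ≋-neg⇒+≋0 {x} p = ≋-trans (+-cong-mod (≋-refl {x}) p) (≋-reflexive (ℤ.+-inverseʳ x))

  *-zeroˡ-mod : ∀ {x} y → x ≋ + 0 [mod d ] → x *ᶻ y ≋ + 0 [mod d ]
  *-zeroˡ-mod y p = ≋-trans (*-cong-mod p (≋-refl {y})) (≋-reflexive (ℤ.*-zeroˡ y))

  *-zeroʳ-mod : ∀ x {y} → y ≋ + 0 [mod d ] → x *ᶻ y ≋ + 0 [mod d ]
  *-zeroʳ-mod x p = ≋-trans (*-cong-mod (≋-refl {x}) p) (≋-reflexive (ℤ.*-zeroʳ x))

  ≋M-reflexive : ∀ {A B} → A ≡ B → A ≋M B [mod d ]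
  ≋M-reflexive refl = mat≋ ≋-refl ≋-refl ≋-refl ≋-refl

  ≋M-sym : ∀ {A B} → A ≋M B [mod d ] → B ≋M A [mod d ]
  ≋M-sym (mat≋ p q r s) = mat≋ (≋-sym p) (≋-sym q) (≋-sym r) (≋-sym s)

  ≋M-trans : ∀ {A B C} → A ≋M B [mod d ] → B ≋M C [mod d ] → A ≋M C [mod d ]
  ≋M-trans (mat≋ p q r s) (mat≋ p′ q′ r′ s′) = mat≋ (≋-trans p p′) (≋-trans q q′) (≋-trans r r′) (≋-trans s s′)

  ≋M⇒≡M-mod : ∀ {A B} → A ≋M B [mod d ] → A ≡M B [mod d ]
  ≋M⇒≡M-mod (mat≋ p q r s) = unwrap p , unwrap q , unwrap r , unwrap s

  ⊗-cong-mod : ∀ {A A′ B B′} → A ≋M A′ [mod d ] → B ≋M B′ [mod d ] → (A ⊗ B) ≋M (A′ ⊗ B′) [mod d ]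
  ⊗-cong-mod {mat _ _ _ _} {mat _ _ _ _} {mat _ _ _ _} {mat _ _ _ _} (mat≋ a b c e) (mat≋ f g h i) =
    mat≋ (+-cong-mod (*-cong-mod a f) (*-cong-mod b h)) (+-cong-mod (*-cong-mod a g) (*-cong-mod b i))
         (+-cong-mod (*-cong-mod c f) (*-cong-mod e h)) (+-cong-mod (*-cong-mod c g) (*-cong-mod e i))

  ⊗-congˡ-mod : ∀ {A A′} → A ≋M A′ [mod d ] → ∀ B → (A ⊗ B) ≋M (A′ ⊗ B) [mod d ]
  ⊗-congˡ-mod p B = ⊗-cong-mod p (≋M-reflexive {B} refl)

  ⊗-congʳ-mod : ∀ A {B B′} → B ≋M B′ [mod d ] → (A ⊗ B) ≋M (A ⊗ B′) [mod d ]
  ⊗-congʳ-mod A = ⊗-cong-mod (≋M-reflexive {A} refl)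

≋M-setoid : ℕ → Setoid _ _
≋M-setoid d = record
  { Carrier = Mat2
  ; _≈_ = _≋M_[mod d ]
  ; isEquivalence = record { refl = ≋M-reflexive refl ; sym = ≋M-sym ; trans = ≋M-trans }
  }

mat-cong : ∀ {a b c d a′ b′ c′ d′} → a ≡ a′ → b ≡ b′ → c ≡ c′ → d ≡ d′ → mat a b c d ≡ mat a′ b′ c′ d′
mat-cong refl refl refl refl = refl

⊗-assoc : ∀ A B C → (A ⊗ B) ⊗ C ≡ A ⊗ (B ⊗ C)
⊗-assoc (mat a b c d) (mat e f g h) (mat i j k l) =
  mat-cong (entry a b e f g h i k) (entry a b e f g h j l) (entry c d e f g h i k) (entry c d e f g h j l)
  where
  entry : ∀ a b e f g h i k → (a *ᶻ e +ᶻ b *ᶻ g) *ᶻ i +ᶻ (a *ᶻ f +ᶻ b *ᶻ h) *ᶻ k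
                            ≡ a *ᶻ (e *ᶻ i +ᶻ f *ᶻ k) +ᶻ b *ᶻ (g *ᶻ i +ᶻ h *ᶻ k)
  entry = solve-∀

antidiag : ℤ → ℤ → Mat2
antidiag x y = mat (+ 0) x y (+ 0)

module _ (a β : ℕ → ℤ) where

  private
    C : ℕ → Mat2
    C = Cmat a β

  prodC-suc : ∀ lo n → prodC a β lo (suc n) ≡ prodC a β (suc lo) n ⊗ C lo
  prodC-suc lo 0 = cong (λ i → C i ⊗ C lo) (ℕ.+-comm lo 1)
  prodC-suc lo (suc n) = begin
    C (lo + suc (suc n)) ⊗ prodC a β lo (suc n)
      ≡⟨ cong (C (lo + suc (suc n)) ⊗_) (prodC-suc lo n) ⟩
    C (lo + suc (suc n)) ⊗ (prodC a β (suc lo) n ⊗ C lo)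
      ≡⟨ sym (⊗-assoc (C (lo + suc (suc n))) (prodC a β (suc lo) n) (C lo)) ⟩
    (C (lo + suc (suc n)) ⊗ prodC a β (suc lo) n) ⊗ C lo
      ≡⟨ cong (λ i → (C i ⊗ prodC a β (suc lo) n) ⊗ C lo) (ℕ.+-suc lo (suc n)) ⟩
    prodC a β (suc lo) (suc n) ⊗ C lo ∎
    where open ≡-Reasoning

  prodC-centred-suc : ∀ k r → suc r ≤ k →
    prodC a β (k ∸ suc r) (2 * suc r) ≡ C (k + suc r) ⊗ (prodC a β (k ∸ r) (2 * r) ⊗ C (k ∸ suc r))
  prodC-centred-suc k r h = begin
    prodC a β lo (2 * suc r)
      ≡⟨ cong (prodC a β lo) (double-suc r) ⟩
    C (lo + suc (suc (2 * r))) ⊗ prodC a β lo (suc (2 * r))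
      ≡⟨ cong (C (lo + suc (suc (2 * r))) ⊗_) (prodC-suc lo (2 * r)) ⟩
    C (lo + suc (suc (2 * r))) ⊗ (prodC a β (suc lo) (2 * r) ⊗ C lo)
      ≡⟨ cong₂ (λ i j → C i ⊗ (prodC a β j (2 * r) ⊗ C lo)) top (sym (ℕ.+-∸-assoc 1 h)) ⟩
    C (k + suc r) ⊗ (prodC a β (k ∸ r) (2 * r) ⊗ C lo) ∎
    where
    open ≡-Reasoning
    lo = k ∸ suc r
    double-suc : ∀ r → 2 * suc r ≡ suc (suc (2 * r))
    double-suc = ℕ-Solver.solve-∀
    shift : ∀ lo r → lo + suc (suc (2 * r)) ≡ lo + suc r + suc r
    shift = ℕ-Solver.solve-∀
    top : lo + suc (suc (2 * r)) ≡ k + suc r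
    top = trans (shift lo r) (cong (_+ suc r) (ℕ.m∸n+n≡m h))

  Cmat-⊗-antidiag : ∀ i x y → C i ⊗ antidiag x y ≡ mat (β i *ᶻ y) (a i *ᶻ x) (+ 0) x
  Cmat-⊗-antidiag i x y = mat-cong (e₁₁ (a i) (β i) y) (e₁₂ (a i) (β i) x) (e₂₁ y) (e₂₂ x)
    where
    e₁₁ : ∀ p q y → p *ᶻ + 0 +ᶻ q *ᶻ y ≡ q *ᶻ y
    e₁₁ = solve-∀
    e₁₂ : ∀ p q x → p *ᶻ x +ᶻ q *ᶻ + 0 ≡ p *ᶻ x
    e₁₂ = solve-∀
    e₂₁ : ∀ y → + 1 *ᶻ + 0 +ᶻ + 0 *ᶻ y ≡ + 0
    e₂₁ = solve-∀
    e₂₂ : ∀ x → + 1 *ᶻ x +ᶻ + 0 *ᶻ + 0 ≡ x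
    e₂₂ = solve-∀

  Cmat-⊗-antidiag-⊗-Cmat : ∀ i j x y →
    C j ⊗ (antidiag x y ⊗ C i) ≡ mat (a j *ᶻ x +ᶻ a i *ᶻ β j *ᶻ y) (β i *ᶻ y *ᶻ β j) x (+ 0)
  Cmat-⊗-antidiag-⊗-Cmat i j x y =
    mat-cong (e₁₁ (a i) (β i) (a j) (β j) x y) (e₁₂ (a i) (β i) (a j) (β j) x y) (e₂₁ (a i) x y) (e₂₂ (β i) x y)
    where
    e₁₁ : ∀ p q p′ q′ x y →
      p′ *ᶻ (+ 0 *ᶻ p +ᶻ x *ᶻ + 1) +ᶻ q′ *ᶻ (y *ᶻ p +ᶻ + 0 *ᶻ + 1) ≡ p′ *ᶻ x +ᶻ p *ᶻ q′ *ᶻ y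
    e₁₁ = solve-∀
    e₁₂ : ∀ p q p′ q′ x y →
      p′ *ᶻ (+ 0 *ᶻ q +ᶻ x *ᶻ + 0) +ᶻ q′ *ᶻ (y *ᶻ q +ᶻ + 0 *ᶻ + 0) ≡ q *ᶻ y *ᶻ q′
    e₁₂ = solve-∀
    e₂₁ : ∀ p x y → + 1 *ᶻ (+ 0 *ᶻ p +ᶻ x *ᶻ + 1) +ᶻ + 0 *ᶻ (y *ᶻ p +ᶻ + 0 *ᶻ + 1) ≡ x
    e₂₁ = solve-∀
    e₂₂ : ∀ q x y → + 1 *ᶻ (+ 0 *ᶻ q +ᶻ x *ᶻ + 0) +ᶻ + 0 *ᶻ (y *ᶻ q +ᶻ + 0 *ᶻ + 0) ≡ + 0
    e₂₂ = solve-∀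

stepProd-suc : ∀ (β : ℕ → ℤ) b n → stepProd β b (suc n) ≡ stepProd β b n *ᶻ β (b + 2 * n)
stepProd-suc β b 0 = trans (ℤ.*-identityʳ (β b)) (sym (trans (ℤ.*-identityˡ _) (cong β (ℕ.+-identityʳ b))))
stepProd-suc β b (suc n) = begin
  β b *ᶻ stepProd β (b + 2) (suc n)
    ≡⟨ cong (β b *ᶻ_) (stepProd-suc β (b + 2) n) ⟩
  β b *ᶻ (stepProd β (b + 2) n *ᶻ β (b + 2 + 2 * n))
    ≡⟨ sym (ℤ.*-assoc (β b) _ _) ⟩
  β b *ᶻ stepProd β (b + 2) n *ᶻ β (b + 2 + 2 * n)
    ≡⟨ cong (λ i → β b *ᶻ stepProd β (b + 2) n *ᶻ β i) (index b n) ⟩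
  β b *ᶻ stepProd β (b + 2) n *ᶻ β (b + 2 * suc n) ∎
  where
  open ≡-Reasoning
  index : ∀ b n → b + 2 + 2 * n ≡ b + 2 * suc n
  index = ℕ-Solver.solve-∀

γ′-stepProd : ∀ β k r → γ' β k r ≡ stepProd β (suc k ∸ r) r
γ′-stepProd β k 0 = refl
γ′-stepProd β k (suc r) = refl

γ-suc : ∀ β k r → suc r ≤ k → γ β k (suc r) ≡ β (k ∸ suc r) *ᶻ γ' β k r *ᶻ β (k + suc r)
γ-suc β k r h = begin
  β lo *ᶻ stepProd β (lo + 2) (suc r)
    ≡⟨ cong (β lo *ᶻ_) (stepProd-suc β (lo + 2) r) ⟩
  β lo *ᶻ (stepProd β (lo + 2) r *ᶻ β (lo + 2 + 2 * r))
    ≡⟨ cong₂ (λ b i → β lo *ᶻ (stepProd β b r *ᶻ β i)) start end ⟩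
  β lo *ᶻ (stepProd β (suc k ∸ r) r *ᶻ β (k + suc r))
    ≡⟨ cong (λ g → β lo *ᶻ (g *ᶻ β (k + suc r))) (sym (γ′-stepProd β k r)) ⟩
  β lo *ᶻ (γ' β k r *ᶻ β (k + suc r))
    ≡⟨ sym (ℤ.*-assoc (β lo) _ _) ⟩
  β lo *ᶻ γ' β k r *ᶻ β (k + suc r) ∎
  where
  open ≡-Reasoning
  lo = k ∸ suc r
  start : lo + 2 ≡ suc k ∸ r
  start = begin
    lo + 2         ≡⟨ ℕ.+-comm lo 2 ⟩
    suc (suc lo)   ≡⟨ cong suc (sym (ℕ.+-∸-assoc 1 h)) ⟩
    suc (k ∸ r)    ≡⟨ sym (ℕ.+-∸-assoc 1 (ℕ.≤-trans (ℕ.n≤1+n r) h)) ⟩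
    suc k ∸ r      ∎
  shift : ∀ lo r → lo + 2 + 2 * r ≡ lo + suc r + suc r
  shift = ℕ-Solver.solve-∀
  end : lo + 2 + 2 * r ≡ k + suc r
  end = trans (shift lo r) (cong (_+ suc r) (ℕ.m∸n+n≡m h))

module _ (a β : ℕ → ℤ) {d k : ℕ} where

  open SetoidReasoning (≋M-setoid d)

  prodC-≋-antidiag : ∀ {k0} → EventuallyNice a β d k k0 → ∀ r → r + k0 ≤ k →
    prodC a β (k ∸ r) (2 * r) ≋M antidiag (γ β k r) (γ' β k r) [mod d ]
  prodC-≋-antidiag (d∣aₖ , _) 0 _ = mat≋ (∣⇒≋0 (a k) d∣aₖ) (≋-reflexive (sym (ℤ.*-identityʳ (β k)))) ≋-refl ≋-refl
  prodC-≋-antidiag {k0} nice@(_ , congruence) (suc r) h = begin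
    prodC a β lo (2 * suc r)
      ≡⟨ prodC-centred-suc a β k r r<k ⟩
    Cmat a β (k + suc r) ⊗ (prodC a β (k ∸ r) (2 * r) ⊗ Cmat a β lo)
      ≈⟨ ⊗-congʳ-mod (Cmat a β (k + suc r)) (⊗-congˡ-mod (prodC-≋-antidiag nice r (ℕ.<⇒≤ h)) (Cmat a β lo)) ⟩
    Cmat a β (k + suc r) ⊗ (antidiag g g′ ⊗ Cmat a β lo)
      ≡⟨ Cmat-⊗-antidiag-⊗-Cmat a β lo (k + suc r) g g′ ⟩
    mat (a (k + suc r) *ᶻ g +ᶻ a lo *ᶻ β (k + suc r) *ᶻ g′) (β lo *ᶻ g′ *ᶻ β (k + suc r)) g (+ 0)
      ≈⟨ mat≋ (≋-neg⇒+≋0 niceness) (≋-reflexive (sym (γ-suc β k r r<k))) ≋-refl ≋-refl ⟩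
    antidiag (γ β k (suc r)) g ∎
    where
    lo = k ∸ suc r
    g = γ β k r
    g′ = γ' β k r
    niceness : a lo *ᶻ β (k + suc r) *ᶻ g′ ≋ - (a (k + suc r) *ᶻ g) [mod d ]
    niceness = wrap (congruence r h)
    r<k : suc r ≤ k
    r<k = ℕ.≤-trans (ℕ.m≤m+n (suc r) k0) h

  prodC-≋-zero : ∀ r → r ≤ k → Perfect a β d r k → prodC a β (k ∸ r) (2 * r + 1) ≋M zeroM [mod d ]
  prodC-≋-zero r h (nice , d∣β₋ , d∣β₊) = begin
    prodC a β (k ∸ r) (2 * r + 1)
      ≡⟨ cong (prodC a β (k ∸ r)) (ℕ.+-comm (2 * r) 1) ⟩
    Cmat a β (k ∸ r + suc (2 * r)) ⊗ prodC a β (k ∸ r) (2 * r)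
      ≡⟨ cong (λ i → Cmat a β i ⊗ prodC a β (k ∸ r) (2 * r)) top ⟩
    Cmat a β (k + r + 1) ⊗ prodC a β (k ∸ r) (2 * r)
      ≈⟨ ⊗-congʳ-mod (Cmat a β (k + r + 1)) (prodC-≋-antidiag nice r (subst (_≤ k) (sym (ℕ.+-identityʳ r)) h)) ⟩
    Cmat a β (k + r + 1) ⊗ antidiag g g′
      ≡⟨ Cmat-⊗-antidiag a β (k + r + 1) g g′ ⟩
    mat (β (k + r + 1) *ᶻ g′) (a (k + r + 1) *ᶻ g) (+ 0) g
      ≈⟨ mat≋ (*-zeroˡ-mod g′ (∣⇒≋0 (β (k + r + 1)) d∣β₊)) (*-zeroʳ-mod (a (k + r + 1)) g≋0) ≋-refl g≋0 ⟩
    zeroM ∎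
    where
    g = γ β k r
    g′ = γ' β k r
    g≋0 : g ≋ + 0 [mod d ]
    g≋0 = *-zeroˡ-mod (stepProd β (k ∸ r + 2) r) (∣⇒≋0 (β (k ∸ r)) d∣β₋)
    shift : ∀ lo r → lo + suc (2 * r) ≡ lo + r + r + 1
    shift = ℕ-Solver.solve-∀
    top : k ∸ r + suc (2 * r) ≡ k + r + 1
    top = trans (shift (k ∸ r) r) (cong (λ n → n + r + 1) (ℕ.m∸n+n≡m h))

lemma1 : (a β : ℕ → ℤ) (d k k0 : ℕ) →
    (EventuallyNice a β d k k0 →
      ∀ r → r + k0 ≤ k →
        prodC a β (k ∸ r) (2 * r) ≡M mat (Data.Integer.+ 0) (γ β k r) (γ' β k r) (Data.Integer.+ 0) [mod d ])
    × (∀ r → r ≤ k → Perfect a β d r k →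
        prodC a β (k ∸ r) (2 * r + 1) ≡M zeroM [mod d ])
lemma1 a β d k k0 =
    (λ nice r h → ≋M⇒≡M-mod (prodC-≋-antidiag a β nice r h))
  , (λ r h perfect → ≋M⇒≡M-mod (prodC-≋-zero a β r h perfect))
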